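{- Let $\mathcal D$ be a collection of upwards closed, first-order definable dependencies. Then for every formula $\phi(\bar x)$ of $\mathrm{FO}(\mathcal D)$ whose free variables are among $\bar x$ there exists a first-order sentence $\phi^*(R)$, where $R$ is a new $|\bar x|$-ary relation symbol, such that \[ M \models_X \phi(\bar x) \iff (M, X(\bar x)) \models \phi^*(R) \] for all models $M$ over the signature of $\phi$ and all teams $X$ over $M$ whose domain contains the variables of $\bar x$. In particular, every sentence of $\mathrm{FO}(\mathcal D)$ is equivalent to some first-order sentence (i.e. true in exactly the same models).
   Context: Team semantics: models have domain $\mathrm{dom}(M)$ with at least two elements. A team $X$ over $M$ with domain a finite set of variables $V$ is a set of assignments $s:V\to\mathrm{dom}(M)$; for a tuple $\bar x$ of variables in $V$, $X(\bar x)=\{s(\bar x): s\in X\}$. Formulas are in negation normal form, and $M\models_X\phi$ is defined by: for a first-order literal $\alpha$, $M\models_X\alpha$ iff every $s\in X$ satisfies $\alpha$ in the Tarskian sense; $M\models_X\psi\vee\theta$ iff $X=Y\cup Z$ for some $Y,Z$ with $M\models_Y\psi$ and $M\models_Z\theta$; $M\models_X\psi\wedge\theta$ iff both hold on $X$; $M\models_X\exists v\psi$ iff there is $H:X\to\mathcal P(\mathrm{dom}(M))\setminus\{\emptyset\}$ with $M\models_{X[H/v]}\psi$, where $X[H/v]=\{s[m/v]: s\in X, m\in H(s)\}$; $M\models_X\forall v\psi$ iff $M\models_{X[M/v]}\psi$, where $X[M/v]=\{s[m/v]: s\in X, m\in\mathrm{dom}(M)\}$. A sentence $\phi$ is true in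 $M$ iff $M\models_{\{\emptyset\}}\phi$ ($\{\emptyset\}$ is the team containing only the empty assignment). A dependency of arity $n$ is a class $\mathbf D$ of structures $(\mathrm{dom}(M),R)$, $R$ an $n$-ary relation, closed under isomorphism; for an $n$-tuple $\bar x$ of variables (repetitions allowed) the atom $\mathbf D\bar x$ is satisfied by $X$ in $M$ iff $(\mathrm{dom}(M),X(\bar x))\in\mathbf D$. $\mathrm{FO}(\mathcal D)$ is first-order logic (in negation normal form) extended with all atoms $\mathbf D\bar x$ for $\mathbf D\in\mathcal D$. $\mathbf D$ is upwards closed if $(\mathrm{dom}(M),R)\in\mathbf D$ and $R\subseteq S$ (same arity) imply $(\mathrm{dom}(M),S)\in\mathbf D$. $\mathbf D$ is first-order definable if there is a first-order sentence $\mathbf D^*(R)$ over $\{R\}$ such that $(\mathrm{dom}(M),R)\in\mathbf D$ iff $(\mathrm{dom}(M),R)\models\mathbf D^*(R)$. -}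

module Defs where

open import Data.Nat using (ℕ; zero; suc)
open import Data.Fin using (Fin; zero; suc)
open import Data.Vec using (Vec; []; _∷_; lookup; map)
open import Data.Product using (Σ; _×_; _,_)
open import Data.Sum using (_⊎_; inj₁; inj₂; [_,_])
open import Data.Unit using (⊤; tt)
open import Data.Empty using (⊥; ⊥-elim)
open import Relation.Nullary using (¬_)
open import Relation.Binary.PropositionalEquality using (_≡_)
open import Level using (Lift; 0ℓ) renaming (suc to lsuc)
open import Function.Bundles using (_↔_; _⇔_; Inverse)

record Sig : Set₁ where
  field
    Rel : Set
    rar : Rel → ℕ
    Fun : Set
    far : Fun → ℕ
open Sig public

data Term (σ : Sig) (n : ℕ) : Set where
  var : Fin n → Term σ n
  app : (f : Fun σ) → Vec (Term σ n) (far σ f) → Term σ n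

record Str (σ : Sig) : Set₁ where
  field
    Carrier : Set
    relI : (R : Rel σ) → Vec Carrier (rar σ R) → Set
    funI : (f : Fun σ) → Vec Carrier (far σ f) → Carrier
open Str public

TwoElems : Set → Set
TwoElems A = Σ A λ a → Σ A λ b → ¬ (a ≡ b)

module _ {σ : Sig} (M : Str σ) where
  mutual
    evalT : ∀ {n} → Vec (Carrier M) n → Term σ n → Carrier M
    evalT ρ (var i) = lookup ρ i
    evalT ρ (app f ts) = funI M f (evalTs ρ ts)

    evalTs : ∀ {n m} → Vec (Carrier M) n → Vec (Term σ n) m → Vec (Carrier M) m
    evalTs ρ [] = []
    evalTs ρ (t ∷ ts) = evalT ρ t ∷ evalTs ρ ts

module _ {σ : Sig} where
  mutual
    renT : ∀ {k n} → (Fin k → Fin n) → Term σ k → Term σ n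
    renT r (var i) = var (r i)
    renT r (app f ts) = app f (renTs r ts)

    renTs : ∀ {k n m} → (Fin k → Fin n) → Vec (Term σ k) m → Vec (Term σ n) m
    renTs r [] = []
    renTs r (t ∷ ts) = renT r t ∷ renTs r ts

lift : ∀ {k n} → (Fin k → Fin n) → Fin (suc k) → Fin (suc n)
lift r zero = zero
lift r (suc i) = suc (r i)

data Lit (σ : Sig) (n : ℕ) : Set where
  rel  : (R : Rel σ) → Vec (Term σ n) (rar σ R) → Lit σ n
  nrel : (R : Rel σ) → Vec (Term σ n) (rar σ R) → Lit σ n
  eq   : Term σ n → Term σ n → Lit σ n
  neq  : Term σ n → Term σ n → Lit σ n

litSat : ∀ {σ n} (M : Str σ) → Vec (Carrier M) n → Lit σ n → Set
litSat M ρ (rel R ts)  = relI M R (evalTs M ρ ts)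
litSat M ρ (nrel R ts) = ¬ relI M R (evalTs M ρ ts)
litSat M ρ (eq t u)    = evalT M ρ t ≡ evalT M ρ u
litSat M ρ (neq t u)   = ¬ (evalT M ρ t ≡ evalT M ρ u)

renL : ∀ {σ k n} → (Fin k → Fin n) → Lit σ k → Lit σ n
renL r (rel R ts)  = rel R (renTs r ts)
renL r (nrel R ts) = nrel R (renTs r ts)
renL r (eq t u)    = eq (renT r t) (renT r u)
renL r (neq t u)   = neq (renT r t) (renT r u)

-- First-order formulas (NNF) and Tarskian semantics.
-- Variable 0 is the one bound by the innermost quantifier.

data FOFm (σ : Sig) : ℕ → Set where
  lit  : ∀ {n} → Lit σ n → FOFm σ n
  _∧_  : ∀ {n} → FOFm σ n → FOFm σ n → FOFm σ n
  _∨_  : ∀ {n} → FOFm σ n → FOFm σ n → FOFm σ n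
  ex   : ∀ {n} → FOFm σ (suc n) → FOFm σ n
  all  : ∀ {n} → FOFm σ (suc n) → FOFm σ n

_⊨[_]_ : ∀ {σ n} (M : Str σ) → Vec (Carrier M) n → FOFm σ n → Set
M ⊨[ ρ ] lit α   = litSat M ρ α
M ⊨[ ρ ] (φ ∧ ψ) = (M ⊨[ ρ ] φ) × (M ⊨[ ρ ] ψ)
M ⊨[ ρ ] (φ ∨ ψ) = (M ⊨[ ρ ] φ) ⊎ (M ⊨[ ρ ] ψ)
M ⊨[ ρ ] ex φ    = Σ (Carrier M) λ a → M ⊨[ a ∷ ρ ] φ
M ⊨[ ρ ] all φ   = (a : Carrier M) → M ⊨[ a ∷ ρ ] φ

-- a dependency of arity n: a class of structures (A , R), R ⊆ A^n
Dep : ℕ → Set₁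
Dep n = (A : Set) → (Vec A n → Set) → Set

IsoClosed : ∀ {n} → Dep n → Set₁
IsoClosed {n} D = ∀ {A B : Set} → TwoElems A → TwoElems B → (f : A ↔ B)
  → (R : Vec A n → Set) (S : Vec B n → Set)
  → (∀ t → R t ⇔ S (map (Inverse.to f) t)) → D A R → D B S

UpwardsClosed : ∀ {n} → Dep n → Set₁
UpwardsClosed {n} D = ∀ {A : Set} → TwoElems A → (R S : Vec A n → Set)
  → (∀ t → R t → S t) → D A R → D A S

sigR : ℕ → Sig
sigR n = record { Rel = ⊤ ; rar = λ _ → n ; Fun = ⊥ ; far = ⊥-elim }

strR : ∀ {n} (A : Set) → (Vec A n → Set) → Str (sigR n)
strR A R = record { Carrier = A ; relI = λ _ → R ; funI = λ () }

FODefinable : ∀ {n} → Dep n → Set₁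
FODefinable {n} D = Σ (FOFm (sigR n) 0) λ φ →
  ∀ (A : Set) → TwoElems A → (R : Vec A n → Set) → D A R ⇔ (strR A R ⊨[ [] ] φ)

-- FO(𝒟) formulas; 𝒟 is given as a family of dependencies indexed by I,
-- with arities ar.

data Fm (σ : Sig) (I : Set) (ar : I → ℕ) : ℕ → Set where
  lit  : ∀ {n} → Lit σ n → Fm σ I ar n
  dep  : ∀ {n} (i : I) → Vec (Fin n) (ar i) → Fm σ I ar n
  _∧_  : ∀ {n} → Fm σ I ar n → Fm σ I ar n → Fm σ I ar n
  _∨_  : ∀ {n} → Fm σ I ar n → Fm σ I ar n → Fm σ I ar n
  ex   : ∀ {n} → Fm σ I ar (suc n) → Fm σ I ar n
  all  : ∀ {n} → Fm σ I ar (suc n) → Fm σ I ar n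

ren : ∀ {σ I ar k n} → (Fin k → Fin n) → Fm σ I ar k → Fm σ I ar n
ren r (lit α)    = lit (renL r α)
ren r (dep i xs) = dep i (map r xs)
ren r (φ ∧ ψ)    = ren r φ ∧ ren r ψ
ren r (φ ∨ ψ)    = ren r φ ∨ ren r ψ
ren r (ex φ)     = ex (ren (lift r) φ)
ren r (all φ)    = all (ren (lift r) φ)

-- Teams: a team over M with domain {0,…,n-1} is a set of assignments

Team : ∀ {σ} → Str σ → ℕ → Set₁
Team M n = Vec (Carrier M) n → Set

proj : ∀ {σ} {M : Str σ} {n k} → Team M n → Vec (Fin n) k → Vec (Carrier M) k → Set
proj {M = M} {n} X xs t = Σ (Vec (Carrier M) n) λ s → X s × (map (lookup s) xs ≡ t)

supp : ∀ {σ} {M : Str σ} {n} (X : Team M n)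
  → ((s : Vec (Carrier M) n) → X s → Carrier M → Set) → Team M (suc n)
supp X H (a ∷ s) = Σ (X s) λ p → H s p a

dup : ∀ {σ} {M : Str σ} {n} → Team M n → Team M (suc n)
dup X (a ∷ s) = X s

unitTeam : ∀ {σ} (M : Str σ) → Team M 0
unitTeam M _ = ⊤

module _ {σ : Sig} {I : Set} {ar : I → ℕ} (D : (i : I) → Dep (ar i)) (M : Str σ) where
  TSat : ∀ {n} → Team M n → Fm σ I ar n → Set₁
  TSat X (lit α) = Lift (lsuc 0ℓ) (∀ s → X s → litSat M s α)
  TSat X (dep i xs) = Lift (lsuc 0ℓ) (D i (Carrier M) (proj {M = M} X xs))
  TSat X (φ ∧ ψ) = TSat X φ × TSat X ψ
  TSat {n} X (φ ∨ ψ) = Σ (Team M n) λ Y → Σ (Team M n) λ Z →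
    (∀ s → X s → Y s ⊎ Z s) × (∀ s → Y s → X s) × (∀ s → Z s → X s)
    × TSat Y φ × TSat Z ψ
  TSat {n} X (ex φ) = Σ ((s : Vec (Carrier M) n) → X s → Carrier M → Set) λ H →
    (∀ s (p : X s) → Σ (Carrier M) (H s p)) × TSat (supp {M = M} X H) φ
  TSat X (all φ) = TSat (dup {M = M} X) φ

_+R_ : Sig → ℕ → Sig
σ +R k = record { Rel = Rel σ ⊎ ⊤ ; rar = [ rar σ , (λ _ → k) ] ; Fun = Fun σ ; far = far σ }

expand : ∀ {σ k} (M : Str σ) → (Vec (Carrier M) k → Set) → Str (σ +R k)
expand {σ} {k} M R = record { Carrier = Carrier M ; relI = ri ; funI = funI M }
  where
    ri : (r : Rel σ ⊎ ⊤) → Vec (Carrier M) (rar (σ +R k) r) → Set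
    ri (inj₁ r) = relI M r
    ri (inj₂ _) = R

Distinct : ∀ {n k} → Vec (Fin n) k → Set
Distinct xs = ∀ i j → lookup xs i ≡ lookup xs j → i ≡ j

module Submission where

-- For upwards closed dependencies, disjunction and existential quantification can always be
-- evaluated maximally.  Writing ⟦φ⟧ᶠ for the assignments satisfying the flattening of φ
-- (dependency atoms replaced by ⊤), X ⊨ φ ∨ ψ iff X ⊆ ⟦φ⟧ᶠ ∪ ⟦ψ⟧ᶠ, X ∩ ⟦φ⟧ᶠ ⊨ φ and X ∩ ⟦ψ⟧ᶠ ⊨ ψ;
-- and X ⊨ ∃v φ iff every s ∈ X has a witness for ⟦φ⟧ᶠ and X[M/v] ∩ ⟦φ⟧ᶠ ⊨ φ.  So every team met
-- while evaluating φ on X is first-order definable from a definition Θ of X(x̄), and satisfaction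
-- can be translated by recursion on φ, carrying Θ along: literals and the covering conditions
-- become ∀x̄ (Θ → …), and an atom D ȳ becomes D* with R replaced by a definition of X(ȳ).

open import Defs
open import Data.Nat using (ℕ; zero; suc; _+_)
open import Data.Fin using (Fin; zero; suc; _↑ˡ_; _↑ʳ_)
open import Data.Vec using (Vec; []; _∷_; lookup; map; tabulate; _++_)
open import Data.Vec.Properties
  using (lookup∘tabulate; tabulate∘lookup; tabulate-cong; lookup-map; lookup-++ˡ; lookup-++ʳ; map-cong; map-id)
open import Data.Product using (Σ; ∃; _×_; _,_; proj₁; proj₂)
open import Data.Product.Function.NonDependent.Propositional using (_×-⇔_)
open import Data.Product.Function.Dependent.Propositional using (congˡ)
open import Data.Sum as Sum using (_⊎_; inj₁; inj₂; [_,_]′)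
open import Data.Sum.Function.Propositional using (_⊎-⇔_)
open import Data.Unit using (tt)
open import Relation.Nullary using (¬_; contradiction)
open import Relation.Nullary.Decidable using (fromSum)
open import Relation.Unary using (_⊆′_; _∩_; _∪_)
open import Axiom.DoubleNegationElimination using (em⇒dne)
open import Relation.Binary.PropositionalEquality using (_≡_; refl; sym; trans; cong; cong₂; subst; _≗_)
open import Function using (_∘_; id)
open import Function.Bundles using (_⇔_; mk⇔; Equivalence)
open import Function.Construct.Composition using (_⇔-∘_)
open import Function.Construct.Symmetry using (⇔-sym)
open import Function.Construct.Identity using (⇔-id)
open import Function.Related.Propositional using (≡⇒; equivalence; module EquationalReasoning)
import Level

open Equivalence using (to; from)
open EquationalReasoning {equivalence}

Σ-⇔ : {A : Set} {P Q : A → Set} → (∀ a → P a ⇔ Q a) → Σ A P ⇔ Σ A Q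
Σ-⇔ P⇔Q = congˡ {k = equivalence} (P⇔Q _)

Π-⇔ : {A : Set} {P Q : A → Set} → (∀ a → P a ⇔ Q a) → ((a : A) → P a) ⇔ ((a : A) → Q a)
Π-⇔ P⇔Q = mk⇔ (λ f a → to (P⇔Q a) (f a)) (λ g a → from (P⇔Q a) (g a))

≡-⇔ : {A B : Set} → A ≡ B → A ⇔ B
≡-⇔ = ≡⇒ {k = equivalence}

Lift-⇔ : ∀ {ℓ} {A : Set} → Level.Lift ℓ A ⇔ A
Lift-⇔ = mk⇔ Level.lower Level.lift

module _ {A : Set} where

  Agree : ∀ {k n} → (Fin k → Fin n) → Vec A n → Vec A k → Set
  Agree r s t = ∀ i → lookup s (r i) ≡ lookup t i

  restrict : ∀ {k n} → Vec A n → (Fin k → Fin n) → Vec A k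
  restrict s r = tabulate (lookup s ∘ r)

  agree-restrict : ∀ {k n} (s : Vec A n) (r : Fin k → Fin n) → Agree r s (restrict s r)
  agree-restrict s r i = sym (lookup∘tabulate (lookup s ∘ r) i)

  agree-lift : ∀ {k n} {r : Fin k → Fin n} {s t} (a : A) → Agree r s t → Agree (lift r) (a ∷ s) (a ∷ t)
  agree-lift a s∘r≡t zero = refl
  agree-lift a s∘r≡t (suc i) = s∘r≡t i

  lookup-ext : ∀ {n} {u v : Vec A n} → (∀ i → lookup u i ≡ lookup v i) → u ≡ v
  lookup-ext {u = u} {v} pointwise = trans (sym (tabulate∘lookup u)) (trans (tabulate-cong pointwise) (tabulate∘lookup v))

  -- For a team X, X ↾ r is the paper's X(x̄) with x̄ = r.
  _↾_ : ∀ {k n} → (Vec A n → Set) → (Fin k → Fin n) → Vec A k → Set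
  (X ↾ r) t = ∃ λ s → X s × Agree r s t

  ↾-∘ : ∀ {j k n} {X : Vec A n → Set} {r : Fin k → Fin n} {g : Fin j → Fin k} t →
        ((X ↾ r) ↾ g) t ⇔ (X ↾ (r ∘ g)) t
  ↾-∘ {r = r} {g} t = mk⇔
    (λ (u , (s , p , s∘r≡u) , u∘g≡t) → s , p , λ i → trans (s∘r≡u (g i)) (u∘g≡t i))
    (λ (s , p , s∘r∘g≡t) → restrict s r , (s , p , agree-restrict s r) ,
       λ i → trans (sym (agree-restrict s r (g i))) (s∘r∘g≡t i))

  ↾-cong : ∀ {k n} {X : Vec A n → Set} {r r′ : Fin k → Fin n} → r ≗ r′ → ∀ t → (X ↾ r) t ⇔ (X ↾ r′) t
  ↾-cong r≗r′ t = Σ-⇔ λ s → Σ-⇔ λ _ → Π-⇔ λ i → ≡-⇔ (cong (λ x → lookup s x ≡ lookup t i) (r≗r′ i))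

↾-lookup : ∀ {σ} {M : Str σ} {k n} (X : Team M n) (xs : Vec (Fin n) k) t → (X ↾ lookup xs) t ⇔ proj {M = M} X xs t
↾-lookup X xs t = Σ-⇔ λ s → Σ-⇔ λ _ → mk⇔
  (λ s∘xs≡t → lookup-ext λ i → trans (lookup-map i (lookup s) xs) (s∘xs≡t i))
  (λ { refl i → sym (lookup-map i (lookup s) xs) })

renF : ∀ {τ k n} → (Fin k → Fin n) → FOFm τ k → FOFm τ n
renF r (lit α) = lit (renL r α)
renF r (φ ∧ ψ) = renF r φ ∧ renF r ψ
renF r (φ ∨ ψ) = renF r φ ∨ renF r ψ
renF r (ex φ) = ex (renF (lift r) φ)
renF r (all φ) = all (renF (lift r) φ)

module _ {τ : Sig} (N : Str τ) where
  mutual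
    evalT-renT : ∀ {k n} {r : Fin k → Fin n} {s t} → Agree r s t → (u : Term τ k) → evalT N s (renT r u) ≡ evalT N t u
    evalT-renT s∘r≡t (var i) = s∘r≡t i
    evalT-renT s∘r≡t (app f us) = cong (funI N f) (evalTs-renTs s∘r≡t us)

    evalTs-renTs : ∀ {k n m} {r : Fin k → Fin n} {s t} → Agree r s t → (us : Vec (Term τ k) m) → evalTs N s (renTs r us) ≡ evalTs N t us
    evalTs-renTs s∘r≡t [] = refl
    evalTs-renTs s∘r≡t (u ∷ us) = cong₂ _∷_ (evalT-renT s∘r≡t u) (evalTs-renTs s∘r≡t us)

  litSat-renL : ∀ {k n} {r : Fin k → Fin n} {s t} → Agree r s t → (α : Lit τ k) → litSat N s (renL r α) ≡ litSat N t α
  litSat-renL s∘r≡t (rel R us)  = cong (relI N R) (evalTs-renTs s∘r≡t us)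
  litSat-renL s∘r≡t (nrel R us) = cong (¬_ ∘ relI N R) (evalTs-renTs s∘r≡t us)
  litSat-renL s∘r≡t (eq u v)    = cong₂ _≡_ (evalT-renT s∘r≡t u) (evalT-renT s∘r≡t v)
  litSat-renL s∘r≡t (neq u v)   = cong₂ (λ a b → ¬ a ≡ b) (evalT-renT s∘r≡t u) (evalT-renT s∘r≡t v)

  ⊨-renF : ∀ {k n} {r : Fin k → Fin n} {s t} → Agree r s t → (θ : FOFm τ k) → (N ⊨[ s ] renF r θ) ⇔ (N ⊨[ t ] θ)
  ⊨-renF s∘r≡t (lit α) = ≡-⇔ (litSat-renL s∘r≡t α)
  ⊨-renF s∘r≡t (φ ∧ ψ) = ⊨-renF s∘r≡t φ ×-⇔ ⊨-renF s∘r≡t ψ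
  ⊨-renF s∘r≡t (φ ∨ ψ) = ⊨-renF s∘r≡t φ ⊎-⇔ ⊨-renF s∘r≡t ψ
  ⊨-renF s∘r≡t (ex φ) = Σ-⇔ λ a → ⊨-renF (agree-lift a s∘r≡t) φ
  ⊨-renF s∘r≡t (all φ) = Π-⇔ λ a → ⊨-renF (agree-lift a s∘r≡t) φ

-- A record rather than a function, so that Θ can be inferred from a proof.
record Defines {τ k} (N : Str τ) (Θ : FOFm τ k) (P : Vec (Carrier N) k → Set) : Set where
  constructor defines
  field pointwise : ∀ t → P t ⇔ (N ⊨[ t ] Θ)

⊤ᶠ : ∀ {τ n} → FOFm τ n
⊤ᶠ = all (lit (eq (var zero) (var zero)))

negL : ∀ {τ n} → Lit τ n → Lit τ n
negL (rel R ts) = nrel R ts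
negL (nrel R ts) = rel R ts
negL (eq t u) = neq t u
negL (neq t u) = eq t u

neg : ∀ {τ n} → FOFm τ n → FOFm τ n
neg (lit α) = lit (negL α)
neg (φ ∧ ψ) = neg φ ∨ neg ψ
neg (φ ∨ ψ) = neg φ ∧ neg ψ
neg (ex φ) = all (neg φ)
neg (all φ) = ex (neg φ)

∀* : ∀ {τ k} → FOFm τ k → FOFm τ 0
∀* {k = zero} φ = φ
∀* {k = suc k} φ = ∀* (all φ)

∃* : ∀ {τ} k {m} → FOFm τ (k + m) → FOFm τ m
∃* zero φ = φ
∃* (suc k) φ = ∃* k (ex φ)

_⟹_ : ∀ {τ k} → FOFm τ k → FOFm τ k → FOFm τ 0
Θ ⟹ G = ∀* (neg Θ ∨ G)

varsEq : ∀ {τ n} m → (Fin m → Fin n) → (Fin m → Fin n) → FOFm τ n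
varsEq zero f g = ⊤ᶠ
varsEq (suc m) f g = lit (eq (var (f zero)) (var (g zero))) ∧ varsEq m (f ∘ suc) (g ∘ suc)

-- ∃x̄ (Θ(x̄) ∧ ⋀ⱼ x_(ys j) = z_j), the bound x̄ preceding the free z̄
image : ∀ {τ k m} → Vec (Fin k) m → FOFm τ k → FOFm τ m
image {k = k} {m} ys Θ = ∃* k (renF (_↑ˡ m) Θ ∧ varsEq m (λ j → lookup ys j ↑ˡ m) (k ↑ʳ_))

module _ {τ : Sig} (N : Str τ) where

  ⊨-⊤ᶠ : ∀ {n} (ρ : Vec (Carrier N) n) → N ⊨[ ρ ] ⊤ᶠ
  ⊨-⊤ᶠ ρ a = refl

  ⊨-∀* : ∀ {k} (φ : FOFm τ k) → (N ⊨[ [] ] ∀* φ) ⇔ (∀ x → N ⊨[ x ] φ)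
  ⊨-∀* {zero} φ = mk⇔ (λ { p [] → p }) (λ f → f [])
  ⊨-∀* {suc k} φ = mk⇔
    (λ { p (a ∷ x) → to (⊨-∀* (all φ)) p x a })
    (λ f → from (⊨-∀* (all φ)) λ x a → f (a ∷ x))

  ⊨-∃* : ∀ k {m} (z : Vec (Carrier N) m) (φ : FOFm τ (k + m)) → (N ⊨[ z ] ∃* k φ) ⇔ (∃ λ x → N ⊨[ x ++ z ] φ)
  ⊨-∃* zero z φ = mk⇔ ([] ,_) (λ { ([] , p) → p })
  ⊨-∃* (suc k) z φ = mk⇔
    (λ p → let (x , a , q) = to (⊨-∃* k z (ex φ)) p in a ∷ x , q)
    (λ { (a ∷ x , q) → from (⊨-∃* k z (ex φ)) (x , a , q) })

  ⊨-varsEq : ∀ {n} m (f g : Fin m → Fin n) (ρ : Vec (Carrier N) n) → (N ⊨[ ρ ] varsEq m f g) ⇔ (∀ j → lookup ρ (f j) ≡ lookup ρ (g j))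
  ⊨-varsEq zero f g ρ = mk⇔ (λ _ ()) (λ _ → ⊨-⊤ᶠ ρ)
  ⊨-varsEq (suc m) f g ρ = mk⇔
    (λ { (e , es) zero → e ; (e , es) (suc j) → to (⊨-varsEq m _ _ ρ) es j })
    (λ es → es zero , from (⊨-varsEq m _ _ ρ) (es ∘ suc))

  image-defines : ∀ {k m} {Θ : FOFm τ k} {P : Vec (Carrier N) k → Set} (ys : Vec (Fin k) m) →
                  Defines N Θ P → Defines N (image ys Θ) (P ↾ lookup ys)
  image-defines {k} {m} {Θ} {P} ys (defines Θ-def) = defines λ z → begin
    (∃ λ x → P x × Agree (lookup ys) x z)
      ∼⟨ Σ-⇔ (λ x → (⇔-sym (⊨-renF N (lookup-++ˡ x z) Θ) ⇔-∘ Θ-def x) ×-⇔ ⇔-sym (⊨-ys≡z x z)) ⟩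
    (∃ λ x → N ⊨[ x ++ z ] (renF (_↑ˡ m) Θ ∧ ys≡z))
      ∼⟨ ⇔-sym (⊨-∃* k z _) ⟩
    N ⊨[ z ] image ys Θ ∎
    where
      ys≡z = varsEq m (λ j → lookup ys j ↑ˡ m) (k ↑ʳ_)
      ⊨-ys≡z : ∀ x z → (N ⊨[ x ++ z ] ys≡z) ⇔ Agree (lookup ys) x z
      ⊨-ys≡z x z = Π-⇔ (λ j → ≡-⇔ (cong₂ _≡_ (lookup-++ˡ x z (lookup ys j)) (lookup-++ʳ x z j))) ⇔-∘ ⊨-varsEq m _ _ (x ++ z)

module Classical (lem : (P : Set) → P ⊎ ¬ P) {τ : Sig} (N : Str τ) where

  dne : {P : Set} → ¬ ¬ P → P
  dne = em⇒dne (fromSum (lem _))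

  ⊨-negL : ∀ {n} (ρ : Vec (Carrier N) n) (α : Lit τ n) → litSat N ρ (negL α) ⇔ (¬ litSat N ρ α)
  ⊨-negL ρ (rel R ts) = mk⇔ id id
  ⊨-negL ρ (nrel R ts) = mk⇔ (λ r ¬r → ¬r r) dne
  ⊨-negL ρ (eq t u) = mk⇔ id id
  ⊨-negL ρ (neq t u) = mk⇔ (λ e ¬e → ¬e e) dne

  ⊨-neg : ∀ {n} (ρ : Vec (Carrier N) n) (φ : FOFm τ n) → (N ⊨[ ρ ] neg φ) ⇔ (¬ N ⊨[ ρ ] φ)
  ⊨-neg ρ (lit α) = ⊨-negL ρ α
  ⊨-neg ρ (φ ∧ ψ) = mk⇔
    (λ { (inj₁ ¬φ) (φρ , _) → to (⊨-neg ρ φ) ¬φ φρ ; (inj₂ ¬ψ) (_ , ψρ) → to (⊨-neg ρ ψ) ¬ψ ψρ })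
    (λ ¬φ∧ψ → [ (λ φρ → inj₂ (from (⊨-neg ρ ψ) (λ ψρ → ¬φ∧ψ (φρ , ψρ)))) , inj₁ ∘ from (⊨-neg ρ φ) ]′ (lem _))
  ⊨-neg ρ (φ ∨ ψ) = mk⇔
    (λ (¬φ , ¬ψ) → [ to (⊨-neg ρ φ) ¬φ , to (⊨-neg ρ ψ) ¬ψ ]′)
    (λ ¬φ∨ψ → from (⊨-neg ρ φ) (¬φ∨ψ ∘ inj₁) , from (⊨-neg ρ ψ) (¬φ∨ψ ∘ inj₂))
  ⊨-neg ρ (ex φ) = mk⇔
    (λ ∀¬φ (a , φa) → to (⊨-neg (a ∷ ρ) φ) (∀¬φ a) φa)
    (λ ¬∃φ a → from (⊨-neg (a ∷ ρ) φ) (λ φa → ¬∃φ (a , φa)))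
  ⊨-neg ρ (all φ) = mk⇔
    (λ (a , ¬φa) ∀φ → to (⊨-neg (a ∷ ρ) φ) ¬φa (∀φ a))
    (λ ¬∀φ → dne λ ¬∃¬φ → ¬∀φ λ a → dne λ ¬φa → ¬∃¬φ (a , from (⊨-neg (a ∷ ρ) φ) ¬φa))

  ⊨-⟹ : ∀ {k} (Θ G : FOFm τ k) → (N ⊨[ [] ] (Θ ⟹ G)) ⇔ (∀ x → N ⊨[ x ] Θ → N ⊨[ x ] G)
  ⊨-⟹ Θ G = Π-⇔ (λ x → mk⇔
    (λ ¬Θ∨G Θx → [ (λ ¬Θ → contradiction Θx (to (⊨-neg x Θ) ¬Θ)) , id ]′ ¬Θ∨G)
    (λ Θ→G → [ inj₂ ∘ Θ→G , inj₁ ∘ from (⊨-neg x Θ) ]′ (lem _))) ⇔-∘ ⊨-∀* N (neg Θ ∨ G)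

-- total: sigR m has no function symbols
varOf : ∀ {m n} → Term (sigR m) n → Fin n
varOf (var i) = i

substRel : ∀ {τ m n} → FOFm (sigR m) n → FOFm τ m → FOFm τ n
substRel (lit (rel _ ts)) Ψ = renF (varOf ∘ lookup ts) Ψ
substRel (lit (nrel _ ts)) Ψ = neg (renF (varOf ∘ lookup ts) Ψ)
substRel (lit (eq t u)) Ψ = lit (eq (var (varOf t)) (var (varOf u)))
substRel (lit (neq t u)) Ψ = lit (neq (var (varOf t)) (var (varOf u)))
substRel (φ ∧ ψ) Ψ = substRel φ Ψ ∧ substRel ψ Ψ
substRel (φ ∨ ψ) Ψ = substRel φ Ψ ∨ substRel ψ Ψ
substRel (ex φ) Ψ = ex (substRel φ Ψ)
substRel (all φ) Ψ = all (substRel φ Ψ)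

module _ (lem : (P : Set) → P ⊎ ¬ P) {τ : Sig} (N : Str τ) {m : ℕ} {P : Vec (Carrier N) m → Set} {Ψ : FOFm τ m}
         (Ψ-def : Defines N Ψ P) where
  open Defines Ψ-def
  open Classical lem N

  private
    S = strR {m} (Carrier N) P

  evalT-varOf : ∀ {n} (ρ : Vec (Carrier N) n) (t : Term (sigR m) n) → evalT S ρ t ≡ lookup ρ (varOf t)
  evalT-varOf ρ (var i) = refl

  agree-varOf : ∀ {n k} (ρ : Vec (Carrier N) n) (ts : Vec (Term (sigR m) n) k) → Agree (varOf ∘ lookup ts) ρ (evalTs S ρ ts)
  agree-varOf ρ (t ∷ ts) zero = sym (evalT-varOf ρ t)
  agree-varOf ρ (t ∷ ts) (suc i) = agree-varOf ρ ts i

  ⊨-rel : ∀ {n} (ρ : Vec (Carrier N) n) (ts : Vec (Term (sigR m) n) m) → P (evalTs S ρ ts) ⇔ (N ⊨[ ρ ] renF (varOf ∘ lookup ts) Ψ)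
  ⊨-rel ρ ts = ⇔-sym (⊨-renF N (agree-varOf ρ ts) Ψ) ⇔-∘ pointwise (evalTs S ρ ts)

  ⊨-substRel : ∀ {n} (ρ : Vec (Carrier N) n) (θ : FOFm (sigR m) n) → (S ⊨[ ρ ] θ) ⇔ (N ⊨[ ρ ] substRel θ Ψ)
  ⊨-substRel ρ (lit (rel _ ts)) = ⊨-rel ρ ts
  ⊨-substRel ρ (lit (nrel _ ts)) = ⇔-sym (⊨-neg ρ (renF (varOf ∘ lookup ts) Ψ)) ⇔-∘ mk⇔ (_∘ from (⊨-rel ρ ts)) (_∘ to (⊨-rel ρ ts))
  ⊨-substRel ρ (lit (eq t u)) = ≡-⇔ (cong₂ _≡_ (evalT-varOf ρ t) (evalT-varOf ρ u))
  ⊨-substRel ρ (lit (neq t u)) = ≡-⇔ (cong₂ (λ a b → ¬ a ≡ b) (evalT-varOf ρ t) (evalT-varOf ρ u))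
  ⊨-substRel ρ (φ ∧ ψ) = ⊨-substRel ρ φ ×-⇔ ⊨-substRel ρ ψ
  ⊨-substRel ρ (φ ∨ ψ) = ⊨-substRel ρ φ ⊎-⇔ ⊨-substRel ρ ψ
  ⊨-substRel ρ (ex φ) = Σ-⇔ λ a → ⊨-substRel (a ∷ ρ) φ
  ⊨-substRel ρ (all φ) = Π-⇔ λ a → ⊨-substRel (a ∷ ρ) φ

module _ {σ : Sig} {k : ℕ} where
  mutual
    embedT : ∀ {n} → Term σ n → Term (σ +R k) n
    embedT (var i) = var i
    embedT (app f ts) = app f (embedTs ts)

    embedTs : ∀ {n m} → Vec (Term σ n) m → Vec (Term (σ +R k) n) m
    embedTs [] = []
    embedTs (t ∷ ts) = embedT t ∷ embedTs ts

  embedL : ∀ {n} → Lit σ n → Lit (σ +R k) n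
  embedL (rel R ts) = rel (inj₁ R) (embedTs ts)
  embedL (nrel R ts) = nrel (inj₁ R) (embedTs ts)
  embedL (eq t u) = eq (embedT t) (embedT u)
  embedL (neq t u) = neq (embedT t) (embedT u)

  embed : ∀ {n} → FOFm σ n → FOFm (σ +R k) n
  embed (lit α) = lit (embedL α)
  embed (φ ∧ ψ) = embed φ ∧ embed ψ
  embed (φ ∨ ψ) = embed φ ∨ embed ψ
  embed (ex φ) = ex (embed φ)
  embed (all φ) = all (embed φ)

  module _ (M : Str σ) (P : Vec (Carrier M) k → Set) where
    mutual
      evalT-embedT : ∀ {n} (ρ : Vec (Carrier M) n) (t : Term σ n) → evalT (expand M P) ρ (embedT t) ≡ evalT M ρ t
      evalT-embedT ρ (var i) = refl
      evalT-embedT ρ (app f ts) = cong (funI M f) (evalTs-embedTs ρ ts)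

      evalTs-embedTs : ∀ {n m} (ρ : Vec (Carrier M) n) (ts : Vec (Term σ n) m) → evalTs (expand M P) ρ (embedTs ts) ≡ evalTs M ρ ts
      evalTs-embedTs ρ [] = refl
      evalTs-embedTs ρ (t ∷ ts) = cong₂ _∷_ (evalT-embedT ρ t) (evalTs-embedTs ρ ts)

    litSat-embedL : ∀ {n} (ρ : Vec (Carrier M) n) (α : Lit σ n) → litSat (expand M P) ρ (embedL α) ≡ litSat M ρ α
    litSat-embedL ρ (rel R ts) = cong (relI M R) (evalTs-embedTs ρ ts)
    litSat-embedL ρ (nrel R ts) = cong (¬_ ∘ relI M R) (evalTs-embedTs ρ ts)
    litSat-embedL ρ (eq t u) = cong₂ _≡_ (evalT-embedT ρ t) (evalT-embedT ρ u)
    litSat-embedL ρ (neq t u) = cong₂ (λ a b → ¬ a ≡ b) (evalT-embedT ρ t) (evalT-embedT ρ u)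

    ⊨-embed : ∀ {n} (ρ : Vec (Carrier M) n) (θ : FOFm σ n) → (expand M P ⊨[ ρ ] embed θ) ⇔ (M ⊨[ ρ ] θ)
    ⊨-embed ρ (lit α) = ≡-⇔ (litSat-embedL ρ α)
    ⊨-embed ρ (φ ∧ ψ) = ⊨-embed ρ φ ×-⇔ ⊨-embed ρ ψ
    ⊨-embed ρ (φ ∨ ψ) = ⊨-embed ρ φ ⊎-⇔ ⊨-embed ρ ψ
    ⊨-embed ρ (ex φ) = Σ-⇔ λ a → ⊨-embed (a ∷ ρ) φ
    ⊨-embed ρ (all φ) = Π-⇔ λ a → ⊨-embed (a ∷ ρ) φ

flatten : ∀ {σ I ar n} → Fm σ I ar n → FOFm σ n
flatten (lit α) = lit α
flatten (dep i xs) = ⊤ᶠ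
flatten (φ ∧ ψ) = flatten φ ∧ flatten ψ
flatten (φ ∨ ψ) = flatten φ ∨ flatten ψ
flatten (ex φ) = ex (flatten φ)
flatten (all φ) = all (flatten φ)

flatten-ren : ∀ {σ I ar k n} (r : Fin k → Fin n) (φ : Fm σ I ar k) → flatten (ren r φ) ≡ renF r (flatten φ)
flatten-ren r (lit α) = refl
flatten-ren r (dep i xs) = refl
flatten-ren r (φ ∧ ψ) = cong₂ _∧_ (flatten-ren r φ) (flatten-ren r ψ)
flatten-ren r (φ ∨ ψ) = cong₂ _∨_ (flatten-ren r φ) (flatten-ren r ψ)
flatten-ren r (ex φ) = cong ex (flatten-ren (lift r) φ)
flatten-ren r (all φ) = cong all (flatten-ren (lift r) φ)

⊨-flatten-ren : ∀ {σ I ar k n} (M : Str σ) {r : Fin k → Fin n} {s t} → Agree r s t → (φ : Fm σ I ar k) →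
                (M ⊨[ s ] flatten (ren r φ)) ⇔ (M ⊨[ t ] flatten φ)
⊨-flatten-ren M {r} {s} s∘r≡t φ = ⊨-renF M s∘r≡t (flatten φ) ⇔-∘ ≡-⇔ (cong (M ⊨[ s ]_) (flatten-ren r φ))

module TeamSemantics {σ : Sig} {I : Set} {ar : I → ℕ} (D : (i : I) → Dep (ar i)) (M : Str σ) where

  ⟦_⟧ : ∀ {n} → FOFm σ n → Team M n
  ⟦ θ ⟧ s = M ⊨[ s ] θ

  tsat⇒flat : ∀ {n} {X : Team M n} (φ : Fm σ I ar n) → TSat D M X φ → X ⊆′ ⟦ flatten φ ⟧
  tsat⇒flat (lit α) (Level.lift Xα) = Xα
  tsat⇒flat (dep i xs) _ s _ = ⊨-⊤ᶠ M s
  tsat⇒flat (φ ∧ ψ) (Xφ , Xψ) s p = tsat⇒flat φ Xφ s p , tsat⇒flat ψ Xψ s p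
  tsat⇒flat (φ ∨ ψ) (Y , Z , X⊆Y∪Z , _ , _ , Yφ , Zψ) s p =
    Sum.map (tsat⇒flat φ Yφ s) (tsat⇒flat ψ Zψ s) (X⊆Y∪Z s p)
  tsat⇒flat (ex φ) (H , H≢∅ , XHφ) s p = let (a , h) = H≢∅ s p in a , tsat⇒flat φ XHφ (a ∷ s) (p , h)
  tsat⇒flat (all φ) XMφ s p a = tsat⇒flat φ XMφ (a ∷ s) p

  module _ (two : TwoElems (Carrier M)) (up : ∀ i → UpwardsClosed (D i)) where

    tsat-extend : ∀ {n} {X Y : Team M n} (φ : Fm σ I ar n) → TSat D M Y φ → Y ⊆′ X → X ⊆′ Y ∪ ⟦ flatten φ ⟧ → TSat D M X φ
    tsat-extend (lit α) (Level.lift Yα) Y⊆X X⊆ = Level.lift λ s p → [ Yα s , id ]′ (X⊆ s p)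
    tsat-extend (dep i xs) (Level.lift d) Y⊆X X⊆ = Level.lift (up i two _ _ (λ t (s , p , e) → s , Y⊆X s p , e) d)
    tsat-extend (φ ∧ ψ) (Yφ , Yψ) Y⊆X X⊆ =
      tsat-extend φ Yφ Y⊆X (λ s p → Sum.map₂ proj₁ (X⊆ s p)) , tsat-extend ψ Yψ Y⊆X (λ s p → Sum.map₂ proj₂ (X⊆ s p))
    tsat-extend {X = X} (φ ∨ ψ) (Y₁ , Y₂ , Y⊆Y₁∪Y₂ , Y₁⊆Y , Y₂⊆Y , Y₁φ , Y₂ψ) Y⊆X X⊆ =
      X₁ , X₂ , X⊆X₁∪X₂ , X₁⊆X , X₂⊆X ,
      tsat-extend φ Y₁φ (λ _ → inj₁) (λ _ → Sum.map₂ proj₂) , tsat-extend ψ Y₂ψ (λ _ → inj₁) (λ _ → Sum.map₂ proj₂)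
      where
        X₁ = Y₁ ∪ (X ∩ ⟦ flatten φ ⟧)
        X₂ = Y₂ ∪ (X ∩ ⟦ flatten ψ ⟧)
        X⊆X₁∪X₂ : X ⊆′ X₁ ∪ X₂
        X⊆X₁∪X₂ s p = [ Sum.map inj₁ inj₁ ∘ Y⊆Y₁∪Y₂ s , Sum.map (inj₂ ∘ (p ,_)) (inj₂ ∘ (p ,_)) ]′ (X⊆ s p)
        X₁⊆X : X₁ ⊆′ X
        X₁⊆X s = [ Y⊆X s ∘ Y₁⊆Y s , proj₁ ]′
        X₂⊆X : X₂ ⊆′ X
        X₂⊆X s = [ Y⊆X s ∘ Y₂⊆Y s , proj₁ ]′
    tsat-extend {n} {X} (ex φ) (H , H≢∅ , YHφ) Y⊆X X⊆ = H′ , H′≢∅ ,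
      tsat-extend φ YHφ (λ { (a ∷ s) (q , h) → Y⊆X s q , inj₁ (q , h) }) (λ { (a ∷ s) (p , h) → h })
      where
        H′ : (s : Vec (Carrier M) n) → X s → Carrier M → Set
        H′ s _ a = (∃ λ q → H s q a) ⊎ M ⊨[ a ∷ s ] flatten φ
        H′≢∅ : ∀ s (p : X s) → ∃ (H′ s p)
        H′≢∅ s p = [ (λ q → let (a , h) = H≢∅ s q in a , inj₁ (q , h)) , (λ (a , f) → a , inj₂ f) ]′ (X⊆ s p)
    tsat-extend (all φ) YMφ Y⊆X X⊆ =
      tsat-extend φ YMφ (λ { (a ∷ s) → Y⊆X s }) (λ { (a ∷ s) p → Sum.map₂ (λ f → f a) (X⊆ s p) })

    ∨-maximal : ∀ {n} {X : Team M n} (φ ψ : Fm σ I ar n) → TSat D M X (φ ∨ ψ) ⇔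
      (X ⊆′ ⟦ flatten (φ ∨ ψ) ⟧ × TSat D M (X ∩ ⟦ flatten φ ⟧) φ × TSat D M (X ∩ ⟦ flatten ψ ⟧) ψ)
    ∨-maximal {X = X} φ ψ = mk⇔
      (λ (Y , Z , X⊆Y∪Z , Y⊆X , Z⊆X , Yφ , Zψ) →
        (λ s p → Sum.map (tsat⇒flat φ Yφ s) (tsat⇒flat ψ Zψ s) (X⊆Y∪Z s p)) ,
        tsat-extend φ Yφ (λ s y → Y⊆X s y , tsat⇒flat φ Yφ s y) (λ _ → inj₂ ∘ proj₂) ,
        tsat-extend ψ Zψ (λ s z → Z⊆X s z , tsat⇒flat ψ Zψ s z) (λ _ → inj₂ ∘ proj₂))
      (λ (X⊆φ∨ψ , Xφ , Xψ) →
        X ∩ ⟦ flatten φ ⟧ , X ∩ ⟦ flatten ψ ⟧ , (λ s p → Sum.map (p ,_) (p ,_) (X⊆φ∨ψ s p)) ,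
        (λ _ → proj₁) , (λ _ → proj₁) , Xφ , Xψ)

    ∃-maximal : ∀ {n} {X : Team M n} (φ : Fm σ I ar (suc n)) → TSat D M X (ex φ) ⇔
      (X ⊆′ ⟦ flatten (ex φ) ⟧ × TSat D M (dup {M = M} X ∩ ⟦ flatten φ ⟧) φ)
    ∃-maximal φ = mk⇔
      (λ (H , H≢∅ , XHφ) →
        (λ s p → let (a , h) = H≢∅ s p in a , tsat⇒flat φ XHφ (a ∷ s) (p , h)) ,
        tsat-extend φ XHφ (λ { (a ∷ s) (p , h) → p , tsat⇒flat φ XHφ (a ∷ s) (p , h) }) (λ { (a ∷ s) → inj₂ ∘ proj₂ }))
      (λ (X⊆∃φ , Xφ) →
        (λ s _ a → M ⊨[ a ∷ s ] flatten φ) , (λ s → X⊆∃φ s) ,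
        tsat-extend φ Xφ (λ { (a ∷ s) → id }) (λ { (a ∷ s) → inj₁ }))

module _ {σ τ : Sig} {I : Set} {ar : I → ℕ} (emb : ∀ {n} → FOFm σ n → FOFm τ n) (D* : (i : I) → FOFm (sigR (ar i)) 0) where

  -- translate φ Θ expresses X ⊨ φ whenever Θ defines X(x̄) for the free variables x̄ of φ.
  translate : ∀ {k} → Fm σ I ar k → FOFm τ k → FOFm τ 0
  translate (lit α) Θ = Θ ⟹ emb (lit α)
  translate (dep i ys) Θ = substRel (D* i) (image ys Θ)
  translate (φ ∧ ψ) Θ = translate φ Θ ∧ translate ψ Θ
  translate (φ ∨ ψ) Θ =
    (Θ ⟹ emb (flatten (φ ∨ ψ))) ∧ (translate φ (Θ ∧ emb (flatten φ)) ∧ translate ψ (Θ ∧ emb (flatten ψ)))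
  translate (ex φ) Θ = (Θ ⟹ emb (flatten (ex φ))) ∧ translate φ (renF suc Θ ∧ emb (flatten φ))
  translate (all φ) Θ = translate φ (renF suc Θ)

module Soundness (lem : (P : Set) → P ⊎ ¬ P) {σ τ : Sig} {I : Set} {ar : I → ℕ}
  (D : (i : I) → Dep (ar i)) (up : ∀ i → UpwardsClosed (D i)) (def : ∀ i → FODefinable (D i))
  (M : Str σ) (two : TwoElems (Carrier M))
  (relN : (R : Rel τ) → Vec (Carrier M) (rar τ R) → Set) (funN : (f : Fun τ) → Vec (Carrier M) (far τ f) → Carrier M) where

  -- given by its fields, so that both M and expand M P are instances up to η
  N : Str τ
  N = record { Carrier = Carrier M ; relI = relN ; funI = funN }

  open TeamSemantics D M
  open Classical lem N

  defines-dup : ∀ {k n} {Θ : FOFm τ k} {r : Fin k → Fin n} {X : Team M n} →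
                 Defines N Θ (X ↾ r) → Defines N (renF suc Θ) (dup {M = M} X ↾ lift r)
  defines-dup {Θ = Θ} (defines Θ-def) = defines λ { (a ∷ t) →
    (⇔-sym (⊨-renF N (λ _ → refl) Θ) ⇔-∘ Θ-def t) ⇔-∘ mk⇔
      (λ { (_ ∷ s , p , s∘r≡t) → s , p , s∘r≡t ∘ suc })
      (λ (s , p , s∘r≡t) → a ∷ s , p , agree-lift a s∘r≡t) }

  defines-proj : ∀ {k n m} {Θ : FOFm τ k} {r : Fin k → Fin n} {X : Team M n} (ys : Vec (Fin k) m) →
                   Defines N Θ (X ↾ r) → Defines N (image ys Θ) (proj {M = M} X (map r ys))
  defines-proj {Θ = Θ} {r} {X} ys Θ-def = defines λ z → begin
    proj {M = M} X (map r ys) z       ∼⟨ ⇔-sym (↾-lookup {M = M} X (map r ys) z) ⟩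
    (X ↾ lookup (map r ys)) z         ∼⟨ ↾-cong (λ j → lookup-map j r ys) z ⟩
    (X ↾ (r ∘ lookup ys)) z           ∼⟨ ⇔-sym (↾-∘ z) ⟩
    ((X ↾ r) ↾ lookup ys) z           ∼⟨ Defines.pointwise (image-defines N ys Θ-def) z ⟩
    N ⊨[ z ] image ys Θ               ∎

  module _ (emb : ∀ {n} → FOFm σ n → FOFm τ n) (⊨-emb : ∀ {n} (ρ : Vec (Carrier M) n) θ → (N ⊨[ ρ ] emb θ) ⇔ (M ⊨[ ρ ] θ)) where

    ⊆-⇔-⟹ : ∀ {k n} {Θ : FOFm τ k} {r : Fin k → Fin n} {X : Team M n} (φ : Fm σ I ar k) →
                 Defines N Θ (X ↾ r) → X ⊆′ ⟦ flatten (ren r φ) ⟧ ⇔ (N ⊨[ [] ] (Θ ⟹ emb (flatten φ)))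
    ⊆-⇔-⟹ {Θ = Θ} {r} φ (defines Θ-def) = ⇔-sym (⊨-⟹ Θ _) ⇔-∘ mk⇔
      (λ X⊆φ t Θt → let (s , p , s∘r≡t) = from (Θ-def t) Θt in
        from (⊨-emb t _) (to (⊨-flatten-ren M s∘r≡t φ) (X⊆φ s p)))
      (λ Θ⊆φ s p → let t = restrict s r in from (⊨-flatten-ren M (agree-restrict s r) φ)
        (to (⊨-emb t _) (Θ⊆φ t (to (Θ-def t) (s , p , agree-restrict s r)))))

    defines-∩ : ∀ {k n} {Θ : FOFm τ k} {r : Fin k → Fin n} {X : Team M n} (φ : Fm σ I ar k) →
                 Defines N Θ (X ↾ r) → Defines N (Θ ∧ emb (flatten φ)) ((X ∩ ⟦ flatten (ren r φ) ⟧) ↾ r)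
    defines-∩ φ (defines Θ-def) = defines λ t → mk⇔
      (λ (s , (p , φs) , s∘r≡t) → to (Θ-def t) (s , p , s∘r≡t) , from (⊨-emb t _) (to (⊨-flatten-ren M s∘r≡t φ) φs))
      (λ (Θt , φt) → let (s , p , s∘r≡t) = from (Θ-def t) Θt in
        s , (p , from (⊨-flatten-ren M s∘r≡t φ) (to (⊨-emb t _) φt)) , s∘r≡t)

    translate-sound : ∀ {k n} (φ : Fm σ I ar k) {Θ : FOFm τ k} (r : Fin k → Fin n) (X : Team M n) →
      Defines N Θ (X ↾ r) → TSat D M X (ren r φ) ⇔ (N ⊨[ [] ] translate emb (proj₁ ∘ def) φ Θ)
    translate-sound (lit α) r X Θ-def = ⊆-⇔-⟹ (lit α) Θ-def ⇔-∘ Lift-⇔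
    translate-sound (dep i ys) r X Θ-def =
      (⊨-substRel lem N (defines-proj ys Θ-def) [] (proj₁ (def i)) ⇔-∘ proj₂ (def i) (Carrier M) two _) ⇔-∘ Lift-⇔
    translate-sound (φ ∧ ψ) r X Θ-def = translate-sound φ r X Θ-def ×-⇔ translate-sound ψ r X Θ-def
    translate-sound (φ ∨ ψ) r X Θ-def =
      (⊆-⇔-⟹ (φ ∨ ψ) Θ-def ×-⇔ translate-sound φ r _ (defines-∩ φ Θ-def) ×-⇔ translate-sound ψ r _ (defines-∩ ψ Θ-def))
      ⇔-∘ ∨-maximal two up (ren r φ) (ren r ψ)
    translate-sound (ex φ) r X Θ-def =
      (⊆-⇔-⟹ (ex φ) Θ-def ×-⇔ translate-sound φ (lift r) _ (defines-∩ φ (defines-dup Θ-def)))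
      ⇔-∘ ∃-maximal two up (ren (lift r) φ)
    translate-sound (all φ) r X Θ-def = translate-sound φ (lift r) (dup {M = M} X) (defines-dup Θ-def)

module _ {σ : Sig} where
  mutual
    renT-id : ∀ {n} {r : Fin n → Fin n} → r ≗ id → (t : Term σ n) → renT r t ≡ t
    renT-id r≗id (var i) = cong var (r≗id i)
    renT-id r≗id (app f ts) = cong (app f) (renTs-id r≗id ts)

    renTs-id : ∀ {n m} {r : Fin n → Fin n} → r ≗ id → (ts : Vec (Term σ n) m) → renTs r ts ≡ ts
    renTs-id r≗id [] = refl
    renTs-id r≗id (t ∷ ts) = cong₂ _∷_ (renT-id r≗id t) (renTs-id r≗id ts)

  renL-id : ∀ {n} {r : Fin n → Fin n} → r ≗ id → (α : Lit σ n) → renL r α ≡ α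
  renL-id r≗id (rel R ts) = cong (rel R) (renTs-id r≗id ts)
  renL-id r≗id (nrel R ts) = cong (nrel R) (renTs-id r≗id ts)
  renL-id r≗id (eq t u) = cong₂ eq (renT-id r≗id t) (renT-id r≗id u)
  renL-id r≗id (neq t u) = cong₂ neq (renT-id r≗id t) (renT-id r≗id u)

  lift-id : ∀ {n} {r : Fin n → Fin n} → r ≗ id → lift r ≗ id
  lift-id r≗id zero = refl
  lift-id r≗id (suc i) = cong suc (r≗id i)

  ren-id : ∀ {I ar n} {r : Fin n → Fin n} → r ≗ id → (φ : Fm σ I ar n) → ren r φ ≡ φ
  ren-id r≗id (lit α) = cong lit (renL-id r≗id α)
  ren-id r≗id (dep i xs) = cong (dep i) (trans (map-cong r≗id xs) (map-id xs))
  ren-id r≗id (φ ∧ ψ) = cong₂ _∧_ (ren-id r≗id φ) (ren-id r≗id ψ)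
  ren-id r≗id (φ ∨ ψ) = cong₂ _∨_ (ren-id r≗id φ) (ren-id r≗id ψ)
  ren-id r≗id (ex φ) = cong ex (ren-id (lift-id r≗id) φ)
  ren-id r≗id (all φ) = cong all (ren-id (lift-id r≗id) φ)

evalTs-tabulate : ∀ {τ} (N : Str τ) {n m} (ρ : Vec (Carrier N) n) (f : Fin m → Term τ n) →
                  evalTs N ρ (tabulate f) ≡ tabulate (evalT N ρ ∘ f)
evalTs-tabulate N {m = zero} ρ f = refl
evalTs-tabulate N {m = suc m} ρ f = cong (evalT N ρ (f zero) ∷_) (evalTs-tabulate N ρ (f ∘ suc))

relAtom : ∀ {σ} k → FOFm (σ +R k) k
relAtom k = lit (rel (inj₂ tt) (tabulate var))

relAtom-defines : ∀ {σ k} (M : Str σ) (P : Vec (Carrier M) k → Set) → Defines (expand M P) (relAtom k) P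
relAtom-defines M P = defines λ t →
  ≡-⇔ (cong P (sym (trans (evalTs-tabulate (expand M P) t var) (tabulate∘lookup t))))

module _ (lem : (P : Set) → P ⊎ ¬ P) {σ : Sig} {I : Set} {ar : I → ℕ} (D : (i : I) → Dep (ar i))
         (up : ∀ i → UpwardsClosed (D i)) (def : ∀ i → FODefinable (D i)) where

  ⊨-translate-relAtom : ∀ {k} (φ : Fm σ I ar k) (M : Str σ) → TwoElems (Carrier M) →
    ∀ {n} (xs : Vec (Fin n) k) (X : Team M n) →
    TSat D M X (ren (lookup xs) φ) ⇔ (expand M (proj {M = M} X xs) ⊨[ [] ] translate embed (proj₁ ∘ def) φ (relAtom k))
  ⊨-translate-relAtom φ M two xs X =
    Soundness.translate-sound lem D up def M two (relI (expand M P)) (funI M) embed (⊨-embed M P) φ (lookup xs) X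
      (defines λ t → Defines.pointwise (relAtom-defines M P) t ⇔-∘ ↾-lookup {M = M} X xs t)
    where P = proj {M = M} X xs

  ⊨-translate-⊤ᶠ : (φ : Fm σ I ar 0) (M : Str σ) → TwoElems (Carrier M) →
    TSat D M (unitTeam M) φ ⇔ (M ⊨[ [] ] translate id (proj₁ ∘ def) φ ⊤ᶠ)
  ⊨-translate-⊤ᶠ φ M two = subst (λ φ′ → TSat D M (unitTeam M) φ′ ⇔ (M ⊨[ [] ] translate id (proj₁ ∘ def) φ ⊤ᶠ)) (ren-id (λ ()) φ)
    (Soundness.translate-sound lem D up def M two (relI M) (funI M) id (λ _ _ → ⇔-id _) φ {⊤ᶠ} (λ ()) (unitTeam M)
      (defines λ { [] → mk⇔ (λ _ → ⊨-⊤ᶠ M []) (λ _ → [] , tt , λ ()) }))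

theorem3p6 : (lem : (P : Set) → P ⊎ ¬ P)
    → (σ : Sig) (I : Set) (ar : I → ℕ) (D : (i : I) → Dep (ar i))
    → (∀ i → IsoClosed (D i)) → (∀ i → UpwardsClosed (D i)) → (∀ i → FODefinable (D i))
    → ((k : ℕ) (φ : Fm σ I ar k) → Σ (FOFm (σ +R k) 0) λ φ* →
          (M : Str σ) → TwoElems (Carrier M) → (n : ℕ) (xs : Vec (Fin n) k) → Distinct xs
          → (X : Team M n) → TSat D M X (ren (lookup xs) φ) ⇔ (expand M (proj {M = M} X xs) ⊨[ [] ] φ*))
      × ((φ : Fm σ I ar 0) → Σ (FOFm σ 0) λ ψ →
          (M : Str σ) → TwoElems (Carrier M) → TSat D M (unitTeam M) φ ⇔ (M ⊨[ [] ] ψ))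
theorem3p6 lem σ I ar D _ up def =
  (λ k φ → translate embed (proj₁ ∘ def) φ (relAtom k) , λ M two n xs _ X → ⊨-translate-relAtom lem D up def φ M two xs X) ,
  (λ φ → translate id (proj₁ ∘ def) φ ⊤ᶠ , ⊨-translate-⊤ᶠ lem D up def φ)
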